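{- Let $f_0(i)=i$ for $i=1,2,\ldots$, and let $f_m$, $c_m(n,k)$ be as in the context. Then for all $1\le k\le n$, \[ c_1(n,k)=\binom{n+k-1}{2k-1}, \] and for every integer $m\ge1$ and $1\le k\le n$, \[ c_m(n,k)=\sum_{i=k}^{n}(m-1)^{i-k}\binom{i-1}{k-1}\binom{n+i-1}{2i-1} \] (with the convention $0^0=1$).
   Context: For $m\ge1$, $f_m$ is the $m$th invert transform of $f_0$: $f_m(0)=1$ and $f_m(n)=\sum_{i=1}^{n} f_{m-1}(i)\,f_m(n-i)$ for $n\ge1$. For $m\ge1$ and $0\le k\le n$: $c_m(0,0)=1$, $c_m(n,0)=0$ for $n\ge1$, and $c_m(n,k)=\sum_{i=1}^{n-k+1} f_{m-1}(i)\,c_m(n-i,k-1)$ for $1\le k\le n$. -}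

module Defs where

open import Data.Nat using (ℕ; zero; suc; _+_; _*_; _∸_; _^_)
open import Data.List using (List; []; _∷_; reverse; zipWith; sum; length)
open import Data.Nat.Combinatorics using (_C_)

sumRange : ℕ → ℕ → (ℕ → ℕ) → ℕ
sumRange a zero      g = 0
sumRange a (suc len) g = g a + sumRange (suc a) len g

-- Σ_{i=a}^{b} g i  (empty sum = 0 when b < a)
sumFromTo : ℕ → ℕ → (ℕ → ℕ) → ℕ
sumFromTo a b g = sumRange a (suc b ∸ a) g

-- For m ≥ 1, f_m is the m-th invert transform of f₀:
-- f_m(0) = 1, f_m(n) = Σ_{i=1}^{n} f_{m-1}(i) f_m(n-i).
-- table m n = [f_m(n), f_m(n-1), …, f_m(0)]  (for m ≥ 1), computed
-- structurally; f (suc m) n is the head of table.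
mutual
  f : ℕ → ℕ → ℕ
  f zero    i = i
  f (suc m) n = headOr (table m n)

  headOr : List ℕ → ℕ
  headOr []      = 0
  headOr (x ∷ _) = x

  -- table m n lists f_{m+1}(n), …, f_{m+1}(0)
  table : ℕ → ℕ → List ℕ
  table m zero    = 1 ∷ []
  table m (suc n) = step m (suc n) 1 (table m n) ∷ table m n

  -- step m N i ys, with ys = [f_{m+1}(N-i), …, f_{m+1}(0)]:
  -- Σ_{j≥i} f_m(j) f_{m+1}(N-j)
  step : ℕ → ℕ → ℕ → List ℕ → ℕ
  step m N i []       = 0
  step m N i (y ∷ ys) = f m i * y + step m N (suc i) ys

-- c_m(n,k) for m ≥ 1 (argument m is the actual m; c 0 is unused):
-- c_m(0,0) = 1, c_m(n,0) = 0 for n ≥ 1,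
-- c_m(n,k) = Σ_{i=1}^{n-k+1} f_{m-1}(i) c_m(n-i,k-1) for k ≥ 1.
c : ℕ → ℕ → ℕ → ℕ
c m zero    zero    = 1
c m (suc n) zero    = 0
c m n       (suc k) = sumFromTo 1 (n ∸ k) (λ i → f (m ∸ 1) i * c m (n ∸ i) k)

-- Write F a = Σ_{n ≥ 1} f a n xⁿ; then ι = F 0 = Σ n xⁿ = x / (1 − x)², and c m n k is the
-- coefficient of xⁿ in (F (m − 1))ᵏ.  The invert transform reads F (a + 1) = F a + F a · F (a + 1),
-- and induction on a turns this into F a = ι + a ι F a, i.e. F a = ι / (1 − a ι).  Hence
-- (F a)ᵏ = Σᵢ a^(i − k) C(i − 1, k − 1) ιⁱ, the coefficients being those of (x / (1 − a x))ᵏ, and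
-- ιⁱ = xⁱ / (1 − x)²ⁱ has coefficient C(n + i − 1, 2i − 1) at xⁿ.  Series are sequences ℕ → ℕ and
-- nothing is ever divided: both sides of the expansion of (F a)ᵏ solve H = u + a ι H, whose
-- solution is unique because ι has no constant term.

module Submission where

open import Algebra.Bundles using (CommutativeSemiring)
open import Algebra.Core using (Op₂)
open import Algebra.Structures using (IsSemigroup)
open import Algebra.Structures.Biased using (isCommutativeMonoidʳ; IsCommutativeSemiringˡ)
open import Data.Nat using (ℕ; zero; suc; _+_; _*_; _∸_; _^_; _≤_; _<_; z≤n; s≤s; s≤s⁻¹)
open import Data.Nat.Combinatorics using (_C_; nCn≡1; nC1≡n; nCk+nC[k+1]≡[n+1]C[k+1]; k>n⇒nCk≡0)
open import Data.Nat.Properties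
open import Data.Nat.Induction using (<-rec)
open import Data.Nat.Tactic.RingSolver using (solve-∀)
open import Data.Empty using (⊥-elim)
open import Data.Product using (_×_; _,_)
open import Level using (0ℓ)
open import Relation.Nullary using (yes; no)
open import Relation.Binary.PropositionalEquality

open import Defs

-- Finite sums

∑< : ℕ → (ℕ → ℕ) → ℕ
∑< zero    t = 0
∑< (suc n) t = ∑< n t + t n

infixl 10 ∑<
syntax ∑< n (λ i → x) = ∑[ i < n ] x

∑-cong : ∀ n {t u : ℕ → ℕ} → (∀ i → i < n → t i ≡ u i) → ∑< n t ≡ ∑< n u
∑-cong zero    eq = refl
∑-cong (suc n) eq = cong₂ _+_ (∑-cong n (λ i i<n → eq i (m<n⇒m<1+n i<n))) (eq n ≤-refl)

∑-zero : ∀ n {t : ℕ → ℕ} → (∀ i → i < n → t i ≡ 0) → ∑< n t ≡ 0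
∑-zero zero    eq = refl
∑-zero (suc n) eq = cong₂ _+_ (∑-zero n (λ i i<n → eq i (m<n⇒m<1+n i<n))) (eq n ≤-refl)

∑-distrib-+ : ∀ n (t u : ℕ → ℕ) → ∑[ i < n ] (t i + u i) ≡ ∑< n t + ∑< n u
∑-distrib-+ zero    t u = refl
∑-distrib-+ (suc n) t u = begin
  ∑[ i < n ] (t i + u i) + (t n + u n) ≡⟨ cong (_+ (t n + u n)) (∑-distrib-+ n t u) ⟩
  ∑< n t + ∑< n u + (t n + u n)       ≡⟨ +-interchange (∑< n t) (∑< n u) (t n) (u n) ⟩
  ∑< n t + t n + (∑< n u + u n)       ∎
  where
  open ≡-Reasoning
  open import Algebra.Properties.CommutativeSemigroup +-commutativeSemigroup
    using () renaming (interchange to +-interchange)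

*-distribˡ-∑ : ∀ n a (t : ℕ → ℕ) → a * ∑< n t ≡ ∑[ i < n ] (a * t i)
*-distribˡ-∑ zero    a t = *-zeroʳ a
*-distribˡ-∑ (suc n) a t =
  trans (*-distribˡ-+ a (∑< n t) (t n)) (cong (_+ a * t n) (*-distribˡ-∑ n a t))

*-distribʳ-∑ : ∀ n a (t : ℕ → ℕ) → ∑< n t * a ≡ ∑[ i < n ] (t i * a)
*-distribʳ-∑ n a t = trans (*-comm (∑< n t) a)
  (trans (*-distribˡ-∑ n a t) (∑-cong n (λ i _ → *-comm a (t i))))

∑-head : ∀ n (t : ℕ → ℕ) → ∑< (suc n) t ≡ t 0 + ∑[ i < n ] t (suc i)
∑-head zero    t = +-comm 0 (t 0)
∑-head (suc n) t = trans (cong (_+ t (suc n)) (∑-head n t)) (+-assoc (t 0) _ _)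

∑-split : ∀ p q (t : ℕ → ℕ) → ∑< (p + q) t ≡ ∑< p t + ∑[ j < q ] t (p + j)
∑-split p zero    t = trans (cong (λ n → ∑< n t) (+-identityʳ p)) (sym (+-identityʳ _))
∑-split p (suc q) t = begin
  ∑< (p + suc q) t                          ≡⟨ cong (λ n → ∑< n t) (+-suc p q) ⟩
  ∑< (p + q) t + t (p + q)                  ≡⟨ cong (_+ t (p + q)) (∑-split p q t) ⟩
  ∑< p t + ∑[ j < q ] t (p + j) + t (p + q) ≡⟨ +-assoc (∑< p t) _ _ ⟩
  ∑< p t + ∑[ j < suc q ] t (p + j)         ∎
  where open ≡-Reasoning

m<o∸n⇒n+m<o : ∀ {m n o} → n ≤ o → m < o ∸ n → n + m < o
m<o∸n⇒n+m<o {m} {n} n≤o m<o∸n = subst (n + m <_) (m+[n∸m]≡n n≤o) (+-monoʳ-< n m<o∸n)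

∑-split-at : ∀ {p} n (t : ℕ → ℕ) → p ≤ n → ∑< n t ≡ ∑< p t + ∑[ j < n ∸ p ] t (p + j)
∑-split-at {p} n t p≤n = trans (cong (λ n → ∑< n t) (sym (m+[n∸m]≡n p≤n))) (∑-split p (n ∸ p) t)

∑-extend : ∀ {p} n (t : ℕ → ℕ) → p ≤ n → (∀ i → p ≤ i → i < n → t i ≡ 0) → ∑< n t ≡ ∑< p t
∑-extend {p} n t p≤n vanish = begin
  ∑< n t                              ≡⟨ ∑-split-at n t p≤n ⟩
  ∑< p t + ∑[ j < n ∸ p ] t (p + j)   ≡⟨ cong (∑< p t +_) (∑-zero (n ∸ p) tail-vanishes) ⟩
  ∑< p t + 0                          ≡⟨ +-identityʳ _ ⟩
  ∑< p t                              ∎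
  where
  open ≡-Reasoning
  tail-vanishes : ∀ j → j < n ∸ p → t (p + j) ≡ 0
  tail-vanishes j j<n∸p = vanish (p + j) (m≤m+n p j) (m<o∸n⇒n+m<o p≤n j<n∸p)

∑-swap : ∀ n m (t : ℕ → ℕ → ℕ) → ∑[ j < n ] ∑[ i < m ] t j i ≡ ∑[ i < m ] ∑[ j < n ] t j i
∑-swap zero    m t = sym (∑-zero m (λ _ _ → refl))
∑-swap (suc n) m t = begin
  ∑[ j < n ] ∑[ i < m ] t j i + ∑[ i < m ] t n i ≡⟨ cong (_+ ∑[ i < m ] t n i) (∑-swap n m t) ⟩
  ∑[ i < m ] ∑[ j < n ] t j i + ∑[ i < m ] t n i ≡⟨ ∑-distrib-+ m _ _ ⟨
  ∑[ i < m ] ∑[ j < suc n ] t j i                 ∎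
  where open ≡-Reasoning

∑-reverse : ∀ n (t : ℕ → ℕ) → ∑< (suc n) t ≡ ∑[ i < suc n ] t (n ∸ i)
∑-reverse zero    t = refl
∑-reverse (suc n) t = begin
  ∑< (suc n) t + t (suc n)                  ≡⟨ cong (_+ t (suc n)) (∑-reverse n t) ⟩
  ∑[ i < suc n ] t (n ∸ i) + t (suc n)      ≡⟨ +-comm _ (t (suc n)) ⟩
  t (suc n) + ∑[ i < suc n ] t (n ∸ i)      ≡⟨ ∑-head (suc n) (λ i → t (suc n ∸ i)) ⟨
  ∑[ i < suc (suc n) ] t (suc n ∸ i)        ∎
  where open ≡-Reasoning

∑-triangle : ∀ n (t : ℕ → ℕ → ℕ) →
  ∑[ m < suc n ] ∑[ i < suc m ] t i (m ∸ i) ≡ ∑[ i < suc n ] ∑[ j < suc (n ∸ i) ] t i j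
∑-triangle zero    t = refl
∑-triangle (suc n) t = begin
  ∑[ m < suc n ] ∑[ i < suc m ] t i (m ∸ i) + (∑[ i < suc n ] t i (suc n ∸ i) + t (suc n) (n ∸ n))
    ≡⟨ cong (_+ (∑[ i < suc n ] t i (suc n ∸ i) + t (suc n) (n ∸ n))) (∑-triangle n t) ⟩
  ∑[ i < suc n ] ∑[ j < suc (n ∸ i) ] t i j + (∑[ i < suc n ] t i (suc n ∸ i) + t (suc n) (n ∸ n))
    ≡⟨ +-assoc (∑[ i < suc n ] ∑[ j < suc (n ∸ i) ] t i j) _ _ ⟨
  ∑[ i < suc n ] ∑[ j < suc (n ∸ i) ] t i j + ∑[ i < suc n ] t i (suc n ∸ i) + t (suc n) (n ∸ n)
    ≡⟨ cong (_+ t (suc n) (n ∸ n)) (∑-distrib-+ (suc n) _ _) ⟨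
  ∑[ i < suc n ] (∑[ j < suc (n ∸ i) ] t i j + t i (suc n ∸ i)) + t (suc n) (n ∸ n)
    ≡⟨ cong₂ _+_ (∑-cong (suc n) extend-row)
                 (sym (cong (λ e → ∑< e (t (suc n)) + t (suc n) (n ∸ n)) (n∸n≡0 n))) ⟩
  ∑[ i < suc (suc n) ] ∑[ j < suc (suc n ∸ i) ] t i j
    ∎
  where
  open ≡-Reasoning
  extend-row : ∀ i → i < suc n →
    ∑[ j < suc (n ∸ i) ] t i j + t i (suc n ∸ i) ≡ ∑[ j < suc (suc n ∸ i) ] t i j
  extend-row i i<1+n rewrite +-∸-assoc 1 (s≤s⁻¹ i<1+n) = refl

sumRange-∑ : ∀ a len t → sumRange a len t ≡ ∑[ j < len ] t (a + j)
sumRange-∑ a zero      t = refl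
sumRange-∑ a (suc len) t = begin
  t a + sumRange (suc a) len t
    ≡⟨ cong₂ _+_ (cong t (sym (+-identityʳ a))) (sumRange-∑ (suc a) len t) ⟩
  t (a + 0) + ∑[ j < len ] t (suc a + j)
    ≡⟨ cong (t (a + 0) +_) (∑-cong len (λ j _ → cong t (sym (+-suc a j)))) ⟩
  t (a + 0) + ∑[ j < len ] t (a + suc j)
    ≡⟨ ∑-head len (λ j → t (a + j)) ⟨
  ∑[ j < suc len ] t (a + j) ∎
  where open ≡-Reasoning

-- Formal power series over ℕ

Series : Set
Series = ℕ → ℕ

infixl 6 _⊕_
infixl 7 _⊛_

_⊕_ : Op₂ Series
(s ⊕ t) n = s n + t n

_⊛_ : Op₂ Series
(s ⊛ t) n = ∑[ i < suc n ] (s i * t (n ∸ i))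

𝟎 𝟏 : Series
𝟎 _       = 0
𝟏 zero    = 1
𝟏 (suc _) = 0

⊕-cong : ∀ {s s′ t t′} → s ≗ s′ → t ≗ t′ → s ⊕ t ≗ s′ ⊕ t′
⊕-cong eq eq′ n = cong₂ _+_ (eq n) (eq′ n)

⊛-cong : ∀ {s s′ t t′} → s ≗ s′ → t ≗ t′ → s ⊛ t ≗ s′ ⊛ t′
⊛-cong eq eq′ n = ∑-cong (suc n) (λ i _ → cong₂ _*_ (eq i) (eq′ (n ∸ i)))

⊛-comm : ∀ s t → s ⊛ t ≗ t ⊛ s
⊛-comm s t n = begin
  ∑[ i < suc n ] (s i * t (n ∸ i))             ≡⟨ ∑-reverse n (λ i → s i * t (n ∸ i)) ⟩
  ∑[ i < suc n ] (s (n ∸ i) * t (n ∸ (n ∸ i))) ≡⟨ ∑-cong (suc n) reflect ⟩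
  ∑[ i < suc n ] (t i * s (n ∸ i))             ∎
  where
  open ≡-Reasoning
  reflect : ∀ i → i < suc n → s (n ∸ i) * t (n ∸ (n ∸ i)) ≡ t i * s (n ∸ i)
  reflect i i<1+n = trans (cong (λ j → s (n ∸ i) * t j) (m∸[m∸n]≡n (s≤s⁻¹ i<1+n))) (*-comm _ (t i))

⊛-assoc : ∀ s t u → (s ⊛ t) ⊛ u ≗ s ⊛ (t ⊛ u)
⊛-assoc s t u n = begin
  ∑[ m < suc n ] (∑[ i < suc m ] (s i * t (m ∸ i)) * u (n ∸ m))
    ≡⟨ ∑-cong (suc n) (λ m _ → *-distribʳ-∑ (suc m) (u (n ∸ m)) (λ i → s i * t (m ∸ i))) ⟩
  ∑[ m < suc n ] ∑[ i < suc m ] (s i * t (m ∸ i) * u (n ∸ m))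
    ≡⟨ ∑-cong (suc n) (λ m m<1+n →
         ∑-cong (suc m) (λ i i<1+m → reassociate m i (s≤s⁻¹ i<1+m) (s≤s⁻¹ m<1+n))) ⟩
  ∑[ m < suc n ] ∑[ i < suc m ] (s i * (t (m ∸ i) * u (n ∸ i ∸ (m ∸ i))))
    ≡⟨ ∑-triangle n (λ i j → s i * (t j * u (n ∸ i ∸ j))) ⟩
  ∑[ i < suc n ] ∑[ j < suc (n ∸ i) ] (s i * (t j * u (n ∸ i ∸ j)))
    ≡⟨ ∑-cong (suc n) (λ i _ → *-distribˡ-∑ (suc (n ∸ i)) (s i) (λ j → t j * u (n ∸ i ∸ j))) ⟨
  ∑[ i < suc n ] (s i * ∑[ j < suc (n ∸ i) ] (t j * u (n ∸ i ∸ j)))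
    ∎
  where
  open ≡-Reasoning
  reassociate : ∀ m i → i ≤ m → m ≤ n →
    s i * t (m ∸ i) * u (n ∸ m) ≡ s i * (t (m ∸ i) * u (n ∸ i ∸ (m ∸ i)))
  reassociate m i i≤m m≤n = trans (*-assoc (s i) _ _)
    (cong (λ j → s i * (t (m ∸ i) * u j))
      (sym (trans (∸-+-assoc n i (m ∸ i)) (cong (n ∸_) (m+[n∸m]≡n i≤m)))))

𝟏-pos : ∀ {n} → 0 < n → 𝟏 n ≡ 0
𝟏-pos {suc n} _ = refl

⊛-identityʳ : ∀ s → s ⊛ 𝟏 ≗ s
⊛-identityʳ s n = begin
  ∑[ i < n ] (s i * 𝟏 (n ∸ i)) + s n * 𝟏 (n ∸ n)
    ≡⟨ cong₂ _+_ (∑-zero n off-diagonal) (cong (λ j → s n * 𝟏 j) (n∸n≡0 n)) ⟩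
  0 + s n * 1
    ≡⟨ *-identityʳ (s n) ⟩
  s n ∎
  where
  open ≡-Reasoning
  off-diagonal : ∀ i → i < n → s i * 𝟏 (n ∸ i) ≡ 0
  off-diagonal i i<n = trans (cong (s i *_) (𝟏-pos (m<n⇒0<n∸m i<n))) (*-zeroʳ (s i))

⊛-distribʳ : ∀ u s t → (s ⊕ t) ⊛ u ≗ s ⊛ u ⊕ t ⊛ u
⊛-distribʳ u s t n = trans (∑-cong (suc n) (λ i _ → *-distribʳ-+ (u (n ∸ i)) (s i) (t i)))
  (∑-distrib-+ (suc n) _ _)

⊛-zeroˡ : ∀ s → 𝟎 ⊛ s ≗ 𝟎
⊛-zeroˡ s n = ∑-zero (suc n) (λ _ _ → refl)

series : CommutativeSemiring 0ℓ 0ℓ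
series = record
  { Carrier = Series
  ; _≈_ = _≗_
  ; _+_ = _⊕_
  ; _*_ = _⊛_
  ; 0# = 𝟎
  ; 1# = 𝟏
  ; isCommutativeSemiring = IsCommutativeSemiringˡ.isCommutativeSemiring (record
    { +-isCommutativeMonoid = isCommutativeMonoidʳ (record
      { isSemigroup = semigroup ⊕-cong (λ s t u n → +-assoc (s n) (t n) (u n))
      ; identityʳ = λ s n → +-identityʳ (s n)
      ; comm = λ s t n → +-comm (s n) (t n)
      })
    ; *-isCommutativeMonoid = isCommutativeMonoidʳ (record
      { isSemigroup = semigroup ⊛-cong ⊛-assoc
      ; identityʳ = ⊛-identityʳ
      ; comm = ⊛-comm
      })
    ; distribʳ = ⊛-distribʳ
    ; zeroˡ = ⊛-zeroˡ
    })
  }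
  where
  semigroup : ∀ {_∙_ : Op₂ Series} →
    (∀ {s s′ t t′} → s ≗ s′ → t ≗ t′ → (s ∙ t) ≗ (s′ ∙ t′)) →
    (∀ s t u → ((s ∙ t) ∙ u) ≗ (s ∙ (t ∙ u))) → IsSemigroup _≗_ _∙_
  semigroup ∙-cong assoc = record
    { isMagma = record
      { isEquivalence = record
        { refl = λ _ → refl
        ; sym = λ eq n → sym (eq n)
        ; trans = λ eq eq′ n → trans (eq n) (eq′ n)
        }
      ; ∙-cong = ∙-cong
      }
    ; assoc = assoc
    }

module S = CommutativeSemiring series
open import Algebra.Definitions.RawSemiring S.rawSemiring using () renaming (_^_ to _^ˢ_)
open import Algebra.Properties.Semiring.Exp S.semiring using (^-congˡ; ^-assocʳ)
open import Algebra.Properties.CommutativeSemiring.Exp series using (^-distrib-*)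

⟨_⟩ : ℕ → Series
⟨ a ⟩ zero    = a
⟨ a ⟩ (suc _) = 0

X : Series
X zero          = 0
X (suc zero)    = 1
X (suc (suc _)) = 0

ones : Series
ones _ = 1

ι : Series
ι n = n

⊛-tail : ∀ s t n → s 0 ≡ 0 → (s ⊛ t) n ≡ ∑[ j < n ] (s (suc j) * t (n ∸ suc j))
⊛-tail s t n s₀≡0 =
  trans (∑-head n (λ i → s i * t (n ∸ i)))
        (cong (λ x → x * t n + ∑[ j < n ] (s (suc j) * t (n ∸ suc j))) s₀≡0)

⟨⟩-⊛ : ∀ a s n → (⟨ a ⟩ ⊛ s) n ≡ a * s n
⟨⟩-⊛ a s n = begin
  (⟨ a ⟩ ⊛ s) n                              ≡⟨ ∑-head n (λ i → ⟨ a ⟩ i * s (n ∸ i)) ⟩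
  a * s n + ∑[ i < n ] (0 * s (n ∸ suc i))   ≡⟨ cong (a * s n +_) (∑-zero n (λ _ _ → refl)) ⟩
  a * s n + 0                                ≡⟨ +-identityʳ _ ⟩
  a * s n                                    ∎
  where open ≡-Reasoning

⟨suc⟩-⊛ : ∀ a s → ⟨ suc a ⟩ ⊛ s ≗ s ⊕ ⟨ a ⟩ ⊛ s
⟨suc⟩-⊛ a s n = trans (⟨⟩-⊛ (suc a) s n) (cong (s n +_) (sym (⟨⟩-⊛ a s n)))

X-⊛ : ∀ s n → (X ⊛ s) (suc n) ≡ s n
X-⊛ s n = begin
  (X ⊛ s) (suc n)                                ≡⟨ ⊛-tail X s (suc n) refl ⟩
  ∑[ j < suc n ] (X (suc j) * s (n ∸ j))         ≡⟨ ∑-head n (λ j → X (suc j) * s (n ∸ j)) ⟩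
  1 * s n + ∑[ j < n ] (0 * s (n ∸ suc j))       ≡⟨ cong (1 * s n +_) (∑-zero n (λ _ _ → refl)) ⟩
  1 * s n + 0                                    ≡⟨ trans (+-identityʳ _) (*-identityˡ _) ⟩
  s n                                            ∎
  where open ≡-Reasoning

X-^ˢ-⊛ : ∀ i s d → (X ^ˢ i ⊛ s) (i + d) ≡ s d
X-^ˢ-⊛ zero    s d = S.*-identityˡ s d
X-^ˢ-⊛ (suc i) s d = begin
  (X ⊛ X ^ˢ i ⊛ s) (suc (i + d))     ≡⟨ S.*-assoc X (X ^ˢ i) s (suc (i + d)) ⟩
  (X ⊛ (X ^ˢ i ⊛ s)) (suc (i + d))   ≡⟨ X-⊛ (X ^ˢ i ⊛ s) (i + d) ⟩
  (X ^ˢ i ⊛ s) (i + d)               ≡⟨ X-^ˢ-⊛ i s d ⟩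
  s d                                ∎
  where open ≡-Reasoning

ones-⊛ : ∀ s n → (ones ⊛ s) n ≡ ∑[ i < suc n ] s i
ones-⊛ s n = trans (⊛-comm ones s n) (∑-cong (suc n) (λ i _ → *-identityʳ (s i)))

-- Series without constant term

∸-suc-< : ∀ {j n} → j < n → n ∸ suc j < n
∸-suc-< j<n = ∸-monoʳ-< (s≤s z≤n) j<n

^ˢ-vanishes : ∀ s → s 0 ≡ 0 → ∀ i {n} → n < i → (s ^ˢ i) n ≡ 0
^ˢ-vanishes s s₀≡0 (suc i) {n} n<1+i = trans (⊛-tail s (s ^ˢ i) n s₀≡0) (∑-zero n vanish)
  where
  vanish : ∀ j → j < n → s (suc j) * (s ^ˢ i) (n ∸ suc j) ≡ 0
  vanish j j<n = trans (cong (s (suc j) *_) (^ˢ-vanishes s s₀≡0 i (<-≤-trans (∸-suc-< j<n) (s≤s⁻¹ n<1+i))))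
    (*-zeroʳ (s (suc j)))

⊛-determined-below : ∀ h {H H′} n → h 0 ≡ 0 → (∀ {j} → j < n → H j ≡ H′ j) → (h ⊛ H) n ≡ (h ⊛ H′) n
⊛-determined-below h {H} {H′} n h₀≡0 agree = begin
  (h ⊛ H) n
    ≡⟨ ⊛-tail h H n h₀≡0 ⟩
  ∑[ j < n ] (h (suc j) * H (n ∸ suc j))
    ≡⟨ ∑-cong n (λ j j<n → cong (h (suc j) *_) (agree (∸-suc-< j<n))) ⟩
  ∑[ j < n ] (h (suc j) * H′ (n ∸ suc j))
    ≡⟨ ⊛-tail h H′ n h₀≡0 ⟨
  (h ⊛ H′) n ∎
  where open ≡-Reasoning

fixpoint-unique : ∀ {h u H H′} → h 0 ≡ 0 → H ≗ u ⊕ h ⊛ H → H′ ≗ u ⊕ h ⊛ H′ → H ≗ H′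
fixpoint-unique {h} {u} {H} {H′} h₀≡0 H-fix H′-fix = <-rec (λ n → H n ≡ H′ n) by-strong-induction
  where
  by-strong-induction : ∀ n → (∀ {j} → j < n → H j ≡ H′ j) → H n ≡ H′ n
  by-strong-induction n agree =
    trans (H-fix n) (trans (cong (u n +_) (⊛-determined-below h n h₀≡0 agree)) (sym (H′-fix n)))

-- Substitution into series without constant term

infixr 9 _∘ˢ_

-- When g 0 ≡ 0 the terms with i > n vanish (^ˢ-vanishes), so this is the full substitution w(g).
_∘ˢ_ : Series → Series → Series
(w ∘ˢ g) n = ∑[ i < suc n ] (w i * (g ^ˢ i) n)

∘ˢ-congˡ : ∀ {w v} g → w ≗ v → w ∘ˢ g ≗ v ∘ˢ g
∘ˢ-congˡ g w≗v n = ∑-cong (suc n) (λ i _ → cong (_* (g ^ˢ i) n) (w≗v i))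

∘ˢ-⊕ : ∀ w v g → (w ⊕ v) ∘ˢ g ≗ w ∘ˢ g ⊕ v ∘ˢ g
∘ˢ-⊕ w v g n = trans (∑-cong (suc n) (λ i _ → *-distribʳ-+ ((g ^ˢ i) n) (w i) (v i)))
  (∑-distrib-+ (suc n) _ _)

∘ˢ-⟨⟩ : ∀ a w g → (⟨ a ⟩ ⊛ w) ∘ˢ g ≗ ⟨ a ⟩ ⊛ (w ∘ˢ g)
∘ˢ-⟨⟩ a w g n = begin
  ∑[ i < suc n ] ((⟨ a ⟩ ⊛ w) i * (g ^ˢ i) n)
    ≡⟨ ∑-cong (suc n) (λ i _ → trans (cong (_* (g ^ˢ i) n) (⟨⟩-⊛ a w i)) (*-assoc a _ _)) ⟩
  ∑[ i < suc n ] (a * (w i * (g ^ˢ i) n))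
    ≡⟨ *-distribˡ-∑ (suc n) a _ ⟨
  a * (w ∘ˢ g) n
    ≡⟨ ⟨⟩-⊛ a (w ∘ˢ g) n ⟨
  (⟨ a ⟩ ⊛ (w ∘ˢ g)) n ∎
  where open ≡-Reasoning

𝟏-∘ˢ : ∀ g → 𝟏 ∘ˢ g ≗ 𝟏
𝟏-∘ˢ g n = begin
  (𝟏 ∘ˢ g) n                                       ≡⟨ ∑-head n (λ i → 𝟏 i * (g ^ˢ i) n) ⟩
  1 * 𝟏 n + ∑[ i < n ] (0 * (g ^ˢ suc i) n)        ≡⟨ cong (1 * 𝟏 n +_) (∑-zero n (λ _ _ → refl)) ⟩
  1 * 𝟏 n + 0                                      ≡⟨ trans (+-identityʳ _) (*-identityˡ _) ⟩
  𝟏 n                                              ∎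
  where open ≡-Reasoning

∘ˢ-X : ∀ w g → g 0 ≡ 0 → (X ⊛ w) ∘ˢ g ≗ g ⊛ (w ∘ˢ g)
∘ˢ-X w g g₀≡0 n = begin
  ((X ⊛ w) ∘ˢ g) n
    ≡⟨ ∑-head n (λ i → (X ⊛ w) i * (g ^ˢ i) n) ⟩
  ∑[ i < n ] ((X ⊛ w) (suc i) * (g ^ˢ suc i) n)
    ≡⟨ ∑-cong n (λ i _ → cong (_* (g ^ˢ suc i) n) (X-⊛ w i)) ⟩
  ∑[ i < n ] (w i * (g ^ˢ suc i) n)
    ≡⟨ +-identityʳ _ ⟨
  ∑[ i < n ] (w i * (g ^ˢ suc i) n) + 0
    ≡⟨ cong (∑[ i < n ] (w i * (g ^ˢ suc i) n) +_) (sym (*-zeroʳ (w n))) ⟩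
  ∑[ i < n ] (w i * (g ^ˢ suc i) n) + w n * 0
    ≡⟨ cong (λ x → ∑[ i < n ] (w i * (g ^ˢ suc i) n) + w n * x) (^ˢ-vanishes g g₀≡0 (suc n) ≤-refl) ⟨
  ∑[ i < suc n ] (w i * ∑[ j < suc n ] (g j * (g ^ˢ i) (n ∸ j)))
    ≡⟨ ∑-cong (suc n) (λ i _ → *-distribˡ-∑ (suc n) (w i) _) ⟩
  ∑[ i < suc n ] ∑[ j < suc n ] (w i * (g j * (g ^ˢ i) (n ∸ j)))
    ≡⟨ ∑-cong (suc n) (λ i _ → ∑-cong (suc n) (λ j _ → x∙yz≈y∙xz (w i) (g j) _)) ⟩
  ∑[ i < suc n ] ∑[ j < suc n ] (g j * (w i * (g ^ˢ i) (n ∸ j)))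
    ≡⟨ ∑-swap (suc n) (suc n) (λ j i → g j * (w i * (g ^ˢ i) (n ∸ j))) ⟨
  ∑[ j < suc n ] ∑[ i < suc n ] (g j * (w i * (g ^ˢ i) (n ∸ j)))
    ≡⟨ ∑-cong (suc n) (λ j _ → *-distribˡ-∑ (suc n) (g j) _) ⟨
  ∑[ j < suc n ] (g j * ∑[ i < suc n ] (w i * (g ^ˢ i) (n ∸ j)))
    ≡⟨ ∑-cong (suc n) (λ j _ → cong (g j *_) (∑-extend (suc n) _ (s≤s (m∸n≤m n j)) (beyond j))) ⟩
  (g ⊛ (w ∘ˢ g)) n
    ∎
  where
  open ≡-Reasoning
  open import Algebra.Properties.CommutativeSemigroup *-commutativeSemigroup using (x∙yz≈y∙xz)
  beyond : ∀ j i → suc (n ∸ j) ≤ i → i < suc n → w i * (g ^ˢ i) (n ∸ j) ≡ 0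
  beyond j i n∸j<i _ = trans (cong (w i *_) (^ˢ-vanishes g g₀≡0 i n∸j<i)) (*-zeroʳ (w i))

-- weight a k = (x / (1 − a x))ᵏ
weight : ℕ → ℕ → Series
weight a zero    i       = 𝟏 i
weight a (suc k) zero    = 0
weight a (suc k) (suc i) = weight a k i + a * weight a (suc k) i

weight-rec : ∀ a k → weight a (suc k) ≗ X ⊛ weight a k ⊕ ⟨ a ⟩ ⊛ (X ⊛ weight a (suc k))
weight-rec a k zero    = sym (*-zeroʳ a)
weight-rec a k (suc i) = sym (cong₂ _+_ (X-⊛ (weight a k) i)
  (trans (⟨⟩-⊛ a (X ⊛ weight a (suc k)) (suc i)) (cong (a *_) (X-⊛ (weight a (suc k)) i))))

^ˢ-as-composition : ∀ {g G} a → g 0 ≡ 0 → G ≗ g ⊕ (⟨ a ⟩ ⊛ g) ⊛ G → ∀ k → G ^ˢ k ≗ weight a k ∘ˢ g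
^ˢ-as-composition {g} a g₀≡0 G-fix zero    n = sym (𝟏-∘ˢ g n)
^ˢ-as-composition {g} {G} a g₀≡0 G-fix (suc k) =
  fixpoint-unique {h = h} {u = g ⊛ G ^ˢ k} h₀≡0 power-fix composition-fix
  where
  open import Relation.Binary.Reasoning.Setoid S.setoid
  h : Series
  h = ⟨ a ⟩ ⊛ g
  h₀≡0 : h 0 ≡ 0
  h₀≡0 = trans (⟨⟩-⊛ a g 0) (trans (cong (a *_) g₀≡0) (*-zeroʳ a))
  power-fix : G ^ˢ suc k ≗ g ⊛ G ^ˢ k ⊕ h ⊛ G ^ˢ suc k
  power-fix = begin
    G ⊛ G ^ˢ k                      ≈⟨ S.*-congʳ {G ^ˢ k} G-fix ⟩
    (g ⊕ h ⊛ G) ⊛ G ^ˢ k            ≈⟨ S.distribʳ (G ^ˢ k) g (h ⊛ G) ⟩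
    g ⊛ G ^ˢ k ⊕ h ⊛ G ⊛ G ^ˢ k     ≈⟨ S.+-congˡ {g ⊛ G ^ˢ k} (S.*-assoc h G (G ^ˢ k)) ⟩
    g ⊛ G ^ˢ k ⊕ h ⊛ G ^ˢ suc k     ∎
  W : ℕ → Series
  W = weight a
  composition-fix : W (suc k) ∘ˢ g ≗ g ⊛ G ^ˢ k ⊕ h ⊛ (W (suc k) ∘ˢ g)
  composition-fix = begin
    W (suc k) ∘ˢ g
      ≈⟨ ∘ˢ-congˡ g (weight-rec a k) ⟩
    (X ⊛ W k ⊕ ⟨ a ⟩ ⊛ (X ⊛ W (suc k))) ∘ˢ g
      ≈⟨ ∘ˢ-⊕ (X ⊛ W k) (⟨ a ⟩ ⊛ (X ⊛ W (suc k))) g ⟩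
    (X ⊛ W k) ∘ˢ g ⊕ (⟨ a ⟩ ⊛ (X ⊛ W (suc k))) ∘ˢ g
      ≈⟨ S.+-cong (∘ˢ-X (W k) g g₀≡0) (∘ˢ-⟨⟩ a (X ⊛ W (suc k)) g) ⟩
    g ⊛ (W k ∘ˢ g) ⊕ ⟨ a ⟩ ⊛ ((X ⊛ W (suc k)) ∘ˢ g)
      ≈⟨ S.+-cong (S.*-congˡ {g} (S.sym (^ˢ-as-composition {g} {G} a g₀≡0 G-fix k)))
                  (S.*-congˡ {⟨ a ⟩} (∘ˢ-X (W (suc k)) g g₀≡0)) ⟩
    g ⊛ G ^ˢ k ⊕ ⟨ a ⟩ ⊛ (g ⊛ (W (suc k) ∘ˢ g))
      ≈⟨ S.+-congˡ {g ⊛ G ^ˢ k} (S.sym (S.*-assoc ⟨ a ⟩ g (W (suc k) ∘ˢ g))) ⟩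
    g ⊛ G ^ˢ k ⊕ h ⊛ (W (suc k) ∘ˢ g)
      ∎

weight-below : ∀ a k i → i < k → weight a k i ≡ 0
weight-below a (suc k) zero    _         = refl
weight-below a (suc k) (suc i) (s≤s i<k) = trans
  (cong₂ (λ x y → x + a * y) (weight-below a k i i<k) (weight-below a (suc k) i (m<n⇒m<1+n i<k)))
  (*-zeroʳ a)

a*a^[i∸1+k]*iC[1+k] : ∀ a k i → a * (a ^ (i ∸ suc k) * (i C suc k)) ≡ a ^ (i ∸ k) * (i C suc k)
a*a^[i∸1+k]*iC[1+k] a k i with i ≤? k
... | yes i≤k rewrite k>n⇒nCk≡0 (s≤s i≤k) =
  trans (cong (a *_) (*-zeroʳ (a ^ (i ∸ suc k)))) (trans (*-zeroʳ a) (sym (*-zeroʳ (a ^ (i ∸ k)))))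
... | no  i≰k = trans (sym (*-assoc a _ _)) (cong (λ e → a ^ e * (i C suc k)) (sym i∸k≡1+[i∸1+k]))
  where
  i∸k≡1+[i∸1+k] : i ∸ k ≡ suc (i ∸ suc k)
  i∸k≡1+[i∸1+k] = +-∸-assoc 1 (≰⇒> i≰k)

weight-closed : ∀ a k i → weight a (suc k) (suc i) ≡ a ^ (i ∸ k) * (i C k)
weight-closed a zero    zero    = cong suc (*-zeroʳ a)
weight-closed a zero    (suc i) = trans (cong (a *_) (weight-closed a zero i)) (sym (*-assoc a (a ^ i) 1))
weight-closed a (suc k) zero    = *-zeroʳ a
weight-closed a (suc k) (suc i) = begin
  weight a (suc k) (suc i) + a * weight a (suc (suc k)) (suc i)
    ≡⟨ cong₂ (λ x y → x + a * y) (weight-closed a k i) (weight-closed a (suc k) i) ⟩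
  a ^ (i ∸ k) * (i C k) + a * (a ^ (i ∸ suc k) * (i C suc k))
    ≡⟨ cong (a ^ (i ∸ k) * (i C k) +_) (a*a^[i∸1+k]*iC[1+k] a k i) ⟩
  a ^ (i ∸ k) * (i C k) + a ^ (i ∸ k) * (i C suc k)
    ≡⟨ *-distribˡ-+ (a ^ (i ∸ k)) (i C k) (i C suc k) ⟨
  a ^ (i ∸ k) * (i C k + i C suc k)
    ≡⟨ cong (a ^ (i ∸ k) *_) (nCk+nC[k+1]≡[n+1]C[k+1] i k) ⟩
  a ^ (i ∸ k) * (suc i C suc k)
    ∎
  where open ≡-Reasoning

-- Powers of ι = x / (1 − x)²

∑-binomial : ∀ j n → ∑[ i < suc n ] ((i + j) C j) ≡ (n + suc j) C suc j
∑-binomial j zero    = trans (nCn≡1 j) (sym (nCn≡1 (suc j)))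
∑-binomial j (suc n) = begin
  ∑[ i < suc n ] ((i + j) C j) + (suc n + j) C j
    ≡⟨ cong₂ _+_ (∑-binomial j n) (cong (_C j) (sym (+-suc n j))) ⟩
  (n + suc j) C suc j + (n + suc j) C j
    ≡⟨ +-comm ((n + suc j) C suc j) _ ⟩
  (n + suc j) C j + (n + suc j) C suc j
    ≡⟨ nCk+nC[k+1]≡[n+1]C[k+1] (n + suc j) j ⟩
  suc (n + suc j) C suc j ∎
  where open ≡-Reasoning

ones-^ˢ : ∀ j n → (ones ^ˢ suc j) n ≡ (n + j) C j
ones-^ˢ zero    n = ⊛-identityʳ ones n
ones-^ˢ (suc j) n = trans (ones-⊛ (ones ^ˢ suc j) n)
  (trans (∑-cong (suc n) (λ i _ → ones-^ˢ j i)) (∑-binomial j n))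

ι≗X⊛ones² : ι ≗ X ⊛ ones ^ˢ 2
ι≗X⊛ones² zero    = refl
ι≗X⊛ones² (suc n) = begin
  suc n               ≡⟨ +-comm 1 n ⟩
  n + 1               ≡⟨ nC1≡n (n + 1) ⟨
  (n + 1) C 1         ≡⟨ ones-^ˢ 1 n ⟨
  (ones ^ˢ 2) n       ≡⟨ X-⊛ (ones ^ˢ 2) n ⟨
  (X ⊛ ones ^ˢ 2) (suc n) ∎
  where open ≡-Reasoning

ι-^ˢ : ∀ i d → (ι ^ˢ suc i) (suc i + d) ≡ (suc i + d + suc i ∸ 1) C (2 * suc i ∸ 1)
ι-^ˢ i d = begin
  (ι ^ˢ suc i) (suc i + d)
    ≡⟨ ^-congˡ (suc i) ι≗X⊛ones² (suc i + d) ⟩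
  ((X ⊛ ones ^ˢ 2) ^ˢ suc i) (suc i + d)
    ≡⟨ ^-distrib-* X (ones ^ˢ 2) (suc i) (suc i + d) ⟩
  (X ^ˢ suc i ⊛ (ones ^ˢ 2) ^ˢ suc i) (suc i + d)
    ≡⟨ S.*-congˡ {X ^ˢ suc i} (^-assocʳ ones 2 (suc i)) (suc i + d) ⟩
  (X ^ˢ suc i ⊛ ones ^ˢ (2 * suc i)) (suc i + d)
    ≡⟨ X-^ˢ-⊛ (suc i) (ones ^ˢ (2 * suc i)) d ⟩
  (ones ^ˢ (2 * suc i)) d
    ≡⟨ ones-^ˢ (i + suc (i + 0)) d ⟩
  (d + (i + suc (i + 0))) C (i + suc (i + 0))
    ≡⟨ cong (_C (2 * suc i ∸ 1)) (reorder i d) ⟩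
  (suc i + d + suc i ∸ 1) C (2 * suc i ∸ 1) ∎
  where
  open ≡-Reasoning
  reorder : ∀ i d → d + (i + suc (i + 0)) ≡ i + d + suc i
  reorder = solve-∀

ι-^ˢ-coefficient : ∀ i n → 1 ≤ i → i ≤ n → (ι ^ˢ i) n ≡ (n + i ∸ 1) C (2 * i ∸ 1)
ι-^ˢ-coefficient (suc i) n _ i<n =
  subst (λ n → (ι ^ˢ suc i) n ≡ (n + suc i ∸ 1) C (2 * suc i ∸ 1)) (m+[n∸m]≡n i<n) (ι-^ˢ i (n ∸ suc i))

-- The generating functions of f and c

-- The constant term f (suc a) 0 = 1 is dropped, matching the sum from i = 1 in the invert transform.
F : ℕ → Series
F a zero    = 0
F a (suc n) = f a (suc n)

step-table : ∀ m N i j → step m N i (table m j) ≡ ∑[ t < suc j ] (f m (i + t) * f (suc m) (j ∸ t))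
step-table m N i zero    = trans (+-identityʳ _) (cong (λ x → f m x * 1) (sym (+-identityʳ i)))
step-table m N i (suc j) = begin
  f m i * f (suc m) (suc j) + step m N (suc i) (table m j)
    ≡⟨ cong₂ _+_ (cong (λ x → f m x * f (suc m) (suc j)) (sym (+-identityʳ i))) (step-table m N (suc i) j) ⟩
  f m (i + 0) * f (suc m) (suc j) + ∑[ t < suc j ] (f m (suc i + t) * f (suc m) (j ∸ t))
    ≡⟨ cong (f m (i + 0) * f (suc m) (suc j) +_)
         (∑-cong (suc j) (λ t _ → cong (λ x → f m x * f (suc m) (j ∸ t)) (sym (+-suc i t)))) ⟩
  f m (i + 0) * f (suc m) (suc j) + ∑[ t < suc j ] (f m (i + suc t) * f (suc m) (j ∸ t))
    ≡⟨ ∑-head (suc j) (λ t → f m (i + t) * f (suc m) (suc j ∸ t)) ⟨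
  ∑[ t < suc (suc j) ] (f m (i + t) * f (suc m) (suc j ∸ t))
    ∎
  where open ≡-Reasoning

f-suc-fixpoint : ∀ a → f (suc a) ≗ 𝟏 ⊕ F a ⊛ f (suc a)
f-suc-fixpoint a zero    = refl
f-suc-fixpoint a (suc n) = trans (step-table a (suc n) 1 n) (sym (⊛-tail (F a) (f (suc a)) (suc n) refl))

F-invert : ∀ a → F (suc a) ≗ F a ⊕ F a ⊛ F (suc a)
F-invert a n = +-cancelˡ-≡ (𝟏 n) _ _ (begin
  𝟏 n + F (suc a) n
    ≡⟨ 𝟏⊕F n ⟨
  f (suc a) n
    ≡⟨ f-suc-fixpoint a n ⟩
  (𝟏 ⊕ F a ⊛ f (suc a)) n
    ≡⟨ S.+-congˡ {𝟏} (S.*-congˡ {F a} 𝟏⊕F) n ⟩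
  (𝟏 ⊕ F a ⊛ (𝟏 ⊕ F (suc a))) n
    ≡⟨ S.+-congˡ {𝟏} (S.distribˡ (F a) 𝟏 (F (suc a))) n ⟩
  (𝟏 ⊕ (F a ⊛ 𝟏 ⊕ F a ⊛ F (suc a))) n
    ≡⟨ S.+-congˡ {𝟏} (S.+-congʳ {F a ⊛ F (suc a)} (S.*-identityʳ (F a))) n ⟩
  𝟏 n + (F a ⊕ F a ⊛ F (suc a)) n ∎)
  where
  open ≡-Reasoning
  𝟏⊕F : f (suc a) ≗ 𝟏 ⊕ F (suc a)
  𝟏⊕F zero    = refl
  𝟏⊕F (suc n) = refl

F-fixpoint : ∀ a → F a ≗ ι ⊕ (⟨ a ⟩ ⊛ ι) ⊛ F a
F-fixpoint zero = begin
  F 0                         ≈⟨ F₀≗ι ⟩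
  ι                           ≈⟨ S.+-identityʳ ι ⟨
  ι ⊕ 𝟎                       ≈⟨ S.+-congˡ {ι} (S.zeroˡ (F 0)) ⟨
  ι ⊕ 𝟎 ⊛ F 0                 ≈⟨ S.+-congˡ {ι} (S.*-congʳ {F 0} (⟨⟩-⊛ 0 ι)) ⟨
  ι ⊕ (⟨ 0 ⟩ ⊛ ι) ⊛ F 0       ∎
  where
  open import Relation.Binary.Reasoning.Setoid S.setoid
  F₀≗ι : F 0 ≗ ι
  F₀≗ι zero    = refl
  F₀≗ι (suc n) = refl
F-fixpoint (suc a) = begin
  H
    ≈⟨ F-invert a ⟩
  G ⊕ G ⊛ H
    ≈⟨ S.+-cong IH (S.*-congʳ {H} IH) ⟩
  (g ⊕ A ⊛ g ⊛ G) ⊕ (g ⊕ A ⊛ g ⊛ G) ⊛ H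
    ≈⟨ rearrange g G H A ⟩
  g ⊕ (g ⊛ H ⊕ A ⊛ g ⊛ (G ⊕ G ⊛ H))
    ≈⟨ S.+-congˡ {g} (S.+-congˡ {g ⊛ H} (S.*-congˡ {A ⊛ g} (F-invert a))) ⟨
  g ⊕ (g ⊛ H ⊕ A ⊛ g ⊛ H)
    ≈⟨ S.+-congˡ {g} (S.distribʳ H g (A ⊛ g)) ⟨
  g ⊕ (g ⊕ A ⊛ g) ⊛ H
    ≈⟨ S.+-congˡ {g} (S.*-congʳ {H} (⟨suc⟩-⊛ a g)) ⟨
  g ⊕ ⟨ suc a ⟩ ⊛ g ⊛ H ∎
  where
  open import Relation.Binary.Reasoning.Setoid S.setoid
  open import Algebra.Solver.Ring.NaturalCoefficients.Default series using (solve; _:=_; _:+_; _:*_)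
  g G H A : Series
  g = ι
  G = F a
  H = F (suc a)
  A = ⟨ a ⟩
  IH : G ≗ g ⊕ (A ⊛ g) ⊛ G
  IH = F-fixpoint a
  rearrange : ∀ g G H A → (g ⊕ A ⊛ g ⊛ G) ⊕ (g ⊕ A ⊛ g ⊛ G) ⊛ H ≗ g ⊕ (g ⊛ H ⊕ A ⊛ g ⊛ (G ⊕ G ⊛ H))
  rearrange = solve 4 (λ g G H A →
    (g :+ A :* g :* G) :+ (g :+ A :* g :* G) :* H := g :+ (g :* H :+ A :* g :* (G :+ G :* H))) S.refl

c-suc : ∀ m n k → c m n (suc k) ≡ ∑[ j < n ∸ k ] (f (m ∸ 1) (suc j) * c m (n ∸ suc j) k)
c-suc m zero    k = sumRange-∑ 1 (zero ∸ k) _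
c-suc m (suc n) k = sumRange-∑ 1 (suc n ∸ k) _

n∸k≤j⇒n∸1+j<k : ∀ {n k j} → n ∸ k ≤ j → j < n → n ∸ suc j < k
n∸k≤j⇒n∸1+j<k {n} {zero}  n≤j j<n = ⊥-elim (<-irrefl refl (≤-<-trans n≤j j<n))
n∸k≤j⇒n∸1+j<k {n} {suc k} {j} n∸k≤j _ = m<n+o⇒m∸n<o n (suc j) (s≤s (begin
  n                   ≤⟨ m≤n+m∸n n (suc k) ⟩
  suc k + (n ∸ suc k) ≤⟨ +-monoʳ-≤ (suc k) n∸k≤j ⟩
  suc k + j           ≡⟨ +-comm (suc k) j ⟩
  j + suc k           ∎))
  where open ≤-Reasoning

c-as-power : ∀ m k n → c m n k ≡ (F (m ∸ 1) ^ˢ k) n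
c-as-power m zero    zero    = refl
c-as-power m zero    (suc n) = refl
c-as-power m (suc k) n = begin
  c m n (suc k)
    ≡⟨ c-suc m n k ⟩
  ∑[ j < n ∸ k ] (f a (suc j) * c m (n ∸ suc j) k)
    ≡⟨ ∑-cong (n ∸ k) (λ j _ → cong (f a (suc j) *_) (c-as-power m k (n ∸ suc j))) ⟩
  ∑[ j < n ∸ k ] (f a (suc j) * (F a ^ˢ k) (n ∸ suc j))
    ≡⟨ ∑-extend n _ (m∸n≤m n k) beyond ⟨
  ∑[ j < n ] (f a (suc j) * (F a ^ˢ k) (n ∸ suc j))
    ≡⟨ ⊛-tail (F a) (F a ^ˢ k) n refl ⟨
  (F a ^ˢ suc k) n ∎
  where
  open ≡-Reasoning
  a : ℕ
  a = m ∸ 1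
  beyond : ∀ j → n ∸ k ≤ j → j < n → f a (suc j) * (F a ^ˢ k) (n ∸ suc j) ≡ 0
  beyond j n∸k≤j j<n = trans (cong (f a (suc j) *_) (^ˢ-vanishes (F a) refl k (n∸k≤j⇒n∸1+j<k n∸k≤j j<n)))
    (*-zeroʳ (f a (suc j)))

c-closed-form : ∀ m n k → 1 ≤ k → k ≤ n →
  c m n k ≡ sumFromTo k n (λ i → (m ∸ 1) ^ (i ∸ k) * ((i ∸ 1) C (k ∸ 1)) * ((n + i ∸ 1) C (2 * i ∸ 1)))
c-closed-form m n (suc k) _ k<n = begin
  c m n (suc k)
    ≡⟨ c-as-power m (suc k) n ⟩
  (F a ^ˢ suc k) n
    ≡⟨ ^ˢ-as-composition a refl (F-fixpoint a) (suc k) n ⟩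
  ∑[ i < suc n ] (weight a (suc k) i * (ι ^ˢ i) n)
    ≡⟨ ∑-split-at (suc n) _ (m≤n⇒m≤1+n k<n) ⟩
  ∑[ i < suc k ] (weight a (suc k) i * (ι ^ˢ i) n)
    + ∑[ j < n ∸ k ] (weight a (suc k) (suc k + j) * (ι ^ˢ (suc k + j)) n)
    ≡⟨ cong₂ _+_ (∑-zero (suc k) below) (∑-cong (n ∸ k) term) ⟩
  ∑[ j < n ∸ k ] T (suc k + j)
    ≡⟨ sumRange-∑ (suc k) (n ∸ k) T ⟨
  sumFromTo (suc k) n T
    ∎
  where
  open ≡-Reasoning
  a : ℕ
  a = m ∸ 1
  T : ℕ → ℕ
  T i = a ^ (i ∸ suc k) * ((i ∸ 1) C k) * ((n + i ∸ 1) C (2 * i ∸ 1))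
  below : ∀ i → i < suc k → weight a (suc k) i * (ι ^ˢ i) n ≡ 0
  below i i<1+k = cong (_* (ι ^ˢ i) n) (weight-below a (suc k) i i<1+k)
  term : ∀ j → j < n ∸ k → weight a (suc k) (suc k + j) * (ι ^ˢ (suc k + j)) n ≡ T (suc k + j)
  term j j<n∸k = cong₂ _*_ (weight-closed a k (k + j))
    (ι-^ˢ-coefficient (suc k + j) n (s≤s z≤n) (m<o∸n⇒n+m<o (<⇒≤ k<n) j<n∸k))

c₁-closed-form : ∀ n k → 1 ≤ k → k ≤ n → c 1 n k ≡ (n + k ∸ 1) C (2 * k ∸ 1)
c₁-closed-form n k 1≤k k≤n = begin
  c 1 n k
    ≡⟨ c-closed-form 1 n k 1≤k k≤n ⟩
  sumFromTo k n T
    ≡⟨ sumRange-∑ k (suc n ∸ k) T ⟩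
  ∑[ j < suc n ∸ k ] T (k + j)
    ≡⟨ cong (λ l → ∑[ j < l ] T (k + j)) (+-∸-assoc 1 k≤n) ⟩
  ∑[ j < suc (n ∸ k) ] T (k + j)
    ≡⟨ ∑-head (n ∸ k) (λ j → T (k + j)) ⟩
  T (k + 0) + ∑[ j < n ∸ k ] T (k + suc j)
    ≡⟨ cong₂ _+_ (cong T (+-identityʳ k)) (∑-zero (n ∸ k) (λ j _ → beyond j)) ⟩
  T k + 0
    ≡⟨ +-identityʳ (T k) ⟩
  T k
    ≡⟨ cong₂ (λ e x → 0 ^ e * x * B) (n∸n≡0 k) (nCn≡1 (k ∸ 1)) ⟩
  1 * B
    ≡⟨ *-identityˡ B ⟩
  B ∎
  where
  open ≡-Reasoning
  B : ℕ
  B = (n + k ∸ 1) C (2 * k ∸ 1)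
  T : ℕ → ℕ
  T i = 0 ^ (i ∸ k) * ((i ∸ 1) C (k ∸ 1)) * ((n + i ∸ 1) C (2 * i ∸ 1))
  beyond : ∀ j → T (k + suc j) ≡ 0
  beyond j = cong (λ e → 0 ^ e * ((i ∸ 1) C (k ∸ 1)) * ((n + i ∸ 1) C (2 * i ∸ 1))) (m+n∸m≡n k (suc j))
    where
    i : ℕ
    i = k + suc j

corollary26 :
    (∀ n k → 1 ≤ k → k ≤ n → c 1 n k ≡ (n + k ∸ 1) C (2 * k ∸ 1))
    × (∀ m n k → 1 ≤ m → 1 ≤ k → k ≤ n →
         c m n k ≡ sumFromTo k n (λ i →
           (m ∸ 1) ^ (i ∸ k) * ((i ∸ 1) C (k ∸ 1)) * ((n + i ∸ 1) C (2 * i ∸ 1))))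
corollary26 = c₁-closed-form , λ m n k _ → c-closed-form m n k
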